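{- Let $G$ be a connected graph with $n\ge 3$ vertices and $m$ edges, and let $\mathrm{leaf}(G)=\{v\in V(G)\mid \deg_G(v)=1\}$. Then $$2|\mathrm{leaf}(G)|\le \gamma_{tc}(M(G))\le n+m-1.$$
   Context: All graphs are finite, simple and undirected. For a graph $H$, a set $D\subseteq V(H)$ is a total dominating set if every vertex of $H$ has a neighbor in $D$. A set $D\subseteq V(H)$ is a total outer-connected dominating set of $H$ if $D$ is a total dominating set and the induced subgraph $H[V(H)\setminus D]$ is connected; $\gamma_{tc}(H)$ denotes the minimum cardinality of a total outer-connected dominating set of $H$. The middle graph $M(G)$ of a graph $G$ has vertex set $V(G)\cup E(G)$, where two elements $x,y$ are adjacent iff either $x,y\in E(G)$ are edges of $G$ sharing an endpoint, or one of them is a vertex of $G$ and the other is an edge of $G$ incident to it. -}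

module Defs where

open import Data.Nat using (ℕ; _+_; _*_; _∸_; _≤_; _<_; _≡ᵇ_)
open import Data.Bool using (Bool; true; false; if_then_else_)
open import Data.Fin using (Fin; zero; suc; toℕ; splitAt)
open import Data.Fin.Subset using (Subset; _∈_; _∉_; ∣_∣)
open import Data.Product using (Σ; ∃; ∃-syntax; _×_; _,_; proj₁; proj₂)
open import Data.Sum using (_⊎_; inj₁; inj₂)
open import Data.Empty using (⊥)
open import Data.Unit using (⊤)
open import Relation.Nullary using (¬_; does)
open import Relation.Binary.PropositionalEquality using (_≡_; _≢_)
open import Data.Fin.Properties using (_≟_)
open import Data.Bool using (_∨_)

count : {k : ℕ} → (Fin k → Bool) → ℕ
count {ℕ.zero}  p = 0
count {ℕ.suc k} p = (if p zero then 1 else 0) + count (λ i → p (suc i))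

-- Each edge e has endpoints (fst e , snd e) with fst e < snd e (no loops,
-- a canonical orientation), and distinct edges have distinct endpoint pairs
-- (no multiple edges).
record Graph (n m : ℕ) : Set where
  field
    ends     : Fin m → Fin n × Fin n
    ordered  : ∀ e → toℕ (proj₁ (ends e)) < toℕ (proj₂ (ends e))
    injective : ∀ e f → ends e ≡ ends f → e ≡ f

module _ {n m : ℕ} (G : Graph n m) where
  open Graph G

  Incident : Fin n → Fin m → Set
  Incident v e = (v ≡ proj₁ (ends e)) ⊎ (v ≡ proj₂ (ends e))

  incident? : Fin n → Fin m → Bool
  incident? v e = does (v ≟ proj₁ (ends e)) ∨ does (v ≟ proj₂ (ends e))

  Adj : Fin n → Fin n → Set
  Adj u v = ∃[ e ] (ends e ≡ (u , v) ⊎ ends e ≡ (v , u))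

  deg : Fin n → ℕ
  deg v = count (incident? v)

  leafCount : ℕ
  leafCount = count (λ v → deg v ≡ᵇ 1)

data Walk {A : Set} (P : A → Set) (R : A → A → Set) : A → A → Set where
  here : ∀ {x} → P x → Walk P R x x
  step : ∀ {x y z} → P x → R x y → Walk P R y z → Walk P R x z

Connected : {n m : ℕ} → Graph n m → Set
Connected {n} G = ∀ (u v : Fin n) → Walk (λ _ → ⊤) (Adj G) u v

-- The middle graph M(G): vertex set V(G) ∪ E(G), encoded as Fin n ⊎ Fin m,
-- and as Fin (n + m) via splitAt (first n = vertices of G, last m = edges of G).
module _ {n m : ℕ} (G : Graph n m) where
  open Graph G

  MAdj⊎ : Fin n ⊎ Fin m → Fin n ⊎ Fin m → Set
  MAdj⊎ (inj₁ u) (inj₁ v) = ⊥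
  MAdj⊎ (inj₁ u) (inj₂ e) = Incident G u e
  MAdj⊎ (inj₂ e) (inj₁ v) = Incident G v e
  MAdj⊎ (inj₂ e) (inj₂ f) = (e ≢ f) × ∃[ v ] (Incident G v e × Incident G v f)

  MAdj : Fin (n + m) → Fin (n + m) → Set
  MAdj x y = MAdj⊎ (splitAt n x) (splitAt n y)

  TotalDominating : Subset (n + m) → Set
  TotalDominating D = ∀ x → ∃[ y ] (y ∈ D × MAdj x y)

  -- M(G)[V(M(G)) ∖ D] is connected (vacuously so if the complement is empty)
  OuterConnected : Subset (n + m) → Set
  OuterConnected D = ∀ x y → x ∉ D → y ∉ D → Walk (λ z → z ∉ D) MAdj x y

  IsTOCDS : Subset (n + m) → Set
  IsTOCDS D = TotalDominating D × OuterConnected D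

-- In M(G) the only neighbour of a leaf v is its pendant edge, so every total dominating set D
-- contains the pendant edges; in a connected graph with n ≥ 3 no edge joins two leaves, so these
-- edges are pairwise distinct. If D also contains every leaf, |D| ≥ 2 |leaf(G)|. Otherwise a leaf
-- outside D is isolated in M(G) - D, so connectivity of M(G) - D forces D to contain all n - 1
-- other vertices, and n - 1 ≥ |leaf(G)| because some vertex is not a leaf.
-- For the upper bound, all of M(G) but one vertex is a total outer-connected dominating set.

module Submission where

open import Defs
open import Data.Nat using (ℕ; zero; suc; _+_; _*_; _∸_; _≤_; z≤n; s≤s; _≡ᵇ_)
open import Data.Nat.Properties
  using (≡ᵇ⇒≡; ≤-refl; ≤-trans; ≤-reflexive; <-irrefl; +-mono-≤; +-assoc; +-identityʳ; m≤n+m;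
         +-commutativeSemigroup; module ≤-Reasoning)
  renaming (_≟_ to _≟ℕ_)
open import Algebra.Properties.CommutativeSemigroup +-commutativeSemigroup using (interchange)
open import Data.Bool using (Bool; true; false; T; if_then_else_; _∧_)
open import Data.Bool.Properties using (T-∧)
open import Data.Empty using (⊥; ⊥-elim)
open import Data.Unit using (tt)
open import Data.Fin using (Fin; zero; suc; _↑ˡ_; _↑ʳ_; splitAt; join; fromℕ<)
open import Data.Fin.Patterns using (0F; 1F; 2F)
open import Data.Fin.Properties
  using (_≟_; any?; 0≢1+n; suc-injective; ↑ˡ-injective; <⇒≢; splitAt-↑ˡ; splitAt-↑ʳ; splitAt⁻¹-↑ʳ; splitAt-join)
open import Data.Fin.Subset using (Subset; _∈_; _∉_; ∣_∣; ∁; ⁅_⁆)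
open import Data.Fin.Subset.Properties using (_∈?_; x∈⁅y⁆⇒x≡y; x∉p⇒x∈∁p; x∉∁p⇒x∈p; ∣∁p∣≡n∸∣p∣; ∣⁅x⁆∣≡1)
open import Data.Vec using ([]; _∷_; lookup)
open import Data.Vec.Properties using ([]=⇒lookup)
open import Data.Product using (∃-syntax; _×_; _,_; proj₁; proj₂)
open import Data.Sum using (_⊎_; inj₁; inj₂; [_,_])
open import Function using (_∘_; Equivalence)
open import Relation.Nullary using (¬_; yes; no; contradiction)
open import Relation.Nullary.Decidable using (T?; ¬?; _×-dec_; decidable-stable)
open import Relation.Binary.PropositionalEquality
  using (_≡_; _≢_; _≗_; refl; sym; trans; cong; cong₂; subst)

𝟙 : Bool → ℕ
𝟙 b = if b then 1 else 0

𝟙≤1 : ∀ b → 𝟙 b ≤ 1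
𝟙≤1 true  = ≤-refl
𝟙≤1 false = z≤n

𝟙-mono : ∀ {a b} → (T a → T b) → 𝟙 a ≤ 𝟙 b
𝟙-mono {false}         _ = z≤n
𝟙-mono {true}  {true}  _ = ≤-refl
𝟙-mono {true}  {false} h = ⊥-elim (h tt)

∑ : {k : ℕ} → (Fin k → ℕ) → ℕ
∑ {zero}  f = 0
∑ {suc k} f = f zero + ∑ (f ∘ suc)

∑-cong : ∀ {k} {f g : Fin k → ℕ} → f ≗ g → ∑ f ≡ ∑ g
∑-cong {zero}  f≗g = refl
∑-cong {suc k} f≗g = cong₂ _+_ (f≗g zero) (∑-cong (f≗g ∘ suc))

∑-mono-≤ : ∀ {k} {f g : Fin k → ℕ} → (∀ i → f i ≤ g i) → ∑ f ≤ ∑ g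
∑-mono-≤ {zero}  f≤g = z≤n
∑-mono-≤ {suc k} f≤g = +-mono-≤ (f≤g zero) (∑-mono-≤ (f≤g ∘ suc))

∑-zero : ∀ k → ∑ {k} (λ _ → 0) ≡ 0
∑-zero zero    = refl
∑-zero (suc k) = ∑-zero k

∑-distrib-+ : ∀ {k} (f g : Fin k → ℕ) → ∑ (λ i → f i + g i) ≡ ∑ f + ∑ g
∑-distrib-+ {zero}  f g = refl
∑-distrib-+ {suc k} f g =
  trans (cong (f zero + g zero +_) (∑-distrib-+ (f ∘ suc) (g ∘ suc)))
        (interchange (f zero) (g zero) _ _)

∑-swap : ∀ {k l} (f : Fin k → Fin l → ℕ) → ∑ (λ i → ∑ (f i)) ≡ ∑ (λ j → ∑ (λ i → f i j))
∑-swap {zero}  {l} f = sym (∑-zero l)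
∑-swap {suc k}     f =
  trans (cong (∑ (f zero) +_) (∑-swap (f ∘ suc)))
        (sym (∑-distrib-+ (f zero) (λ j → ∑ (λ i → f (suc i) j))))

count≡∑ : ∀ {k} (p : Fin k → Bool) → count p ≡ ∑ (𝟙 ∘ p)
count≡∑ {zero}  p = refl
count≡∑ {suc k} p = cong (𝟙 (p zero) +_) (count≡∑ (p ∘ suc))

count-mono : ∀ {k} (p q : Fin k → Bool) → (∀ i → T (p i) → T (q i)) → count p ≤ count q
count-mono p q p⊆q = begin
  count p     ≡⟨ count≡∑ p ⟩
  ∑ (𝟙 ∘ p)   ≤⟨ ∑-mono-≤ (λ i → 𝟙-mono (p⊆q i)) ⟩
  ∑ (𝟙 ∘ q)   ≡⟨ count≡∑ q ⟨
  count q     ∎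
  where open ≤-Reasoning

count≤n : ∀ {k} (p : Fin k → Bool) → count p ≤ k
count≤n {zero}  p = z≤n
count≤n {suc k} p = +-mono-≤ (𝟙≤1 (p zero)) (count≤n (p ∘ suc))

count≡0 : ∀ {k} (p : Fin k → Bool) → (∀ i → ¬ T (p i)) → count p ≡ 0
count≡0 {zero}  p none = refl
count≡0 {suc k} p none with p zero | none zero
... | false | _   = count≡0 (p ∘ suc) (none ∘ suc)
... | true  | ¬p₀ = ⊥-elim (¬p₀ tt)

count-pos : ∀ {k} (p : Fin k → Bool) {i} → T (p i) → 1 ≤ count p
count-pos p {zero}  pᵢ with p zero | pᵢ
... | true | _ = s≤s z≤n
count-pos p {suc i} pᵢ = ≤-trans (count-pos (p ∘ suc) pᵢ) (m≤n+m _ (𝟙 (p zero)))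

count-pair : ∀ {k} (p : Fin k → Bool) {i j} → i ≢ j → T (p i) → T (p j) → 2 ≤ count p
count-pair p {zero}  {zero}  i≢j _  _  = contradiction refl i≢j
count-pair p {zero}  {suc j} _   pᵢ pⱼ with p zero | pᵢ
... | true | _ = s≤s (count-pos (p ∘ suc) pⱼ)
count-pair p {suc i} {zero}  i≢j pᵢ pⱼ = count-pair p (i≢j ∘ sym) pⱼ pᵢ
count-pair p {suc i} {suc j} i≢j pᵢ pⱼ =
  ≤-trans (count-pair (p ∘ suc) (i≢j ∘ cong suc) pᵢ pⱼ) (m≤n+m _ (𝟙 (p zero)))

count≡1⇒unique : ∀ {k} (p : Fin k → Bool) {i j} → count p ≡ 1 → T (p i) → T (p j) → i ≡ j
count≡1⇒unique p {i} {j} c pᵢ pⱼ with i ≟ j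
... | yes i≡j = i≡j
... | no  i≢j = contradiction (count-pair p i≢j pᵢ pⱼ) (<-irrefl (sym c))

count≤1 : ∀ {k} (p : Fin k → Bool) → (∀ i j → T (p i) → T (p j) → i ≡ j) → count p ≤ 1
count≤1 {zero}  p unique = z≤n
count≤1 {suc k} p unique with p zero in p₀
... | true  = ≤-reflexive (cong suc (count≡0 (p ∘ suc)
                (λ i pᵢ → 0≢1+n (unique zero (suc i) (subst T (sym p₀) tt) pᵢ))))
... | false = count≤1 (p ∘ suc) (λ i j pᵢ pⱼ → suc-injective (unique (suc i) (suc j) pᵢ pⱼ))

count≤n∸1 : ∀ {k} (p : Fin k → Bool) {j} → ¬ T (p j) → count p ≤ k ∸ 1
count≤n∸1 {suc k}       p {zero}  ¬pⱼ with p zero | ¬pⱼ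
... | false | _   = count≤n (p ∘ suc)
... | true  | ¬p₀ = ⊥-elim (¬p₀ tt)
count≤n∸1 {suc zero}    p {suc ()}
count≤n∸1 {suc (suc k)} p {suc j} ¬pⱼ = +-mono-≤ (𝟙≤1 (p zero)) (count≤n∸1 (p ∘ suc) ¬pⱼ)

n≤count : ∀ {k} (p : Fin k → Bool) → (∀ i → T (p i)) → k ≤ count p
n≤count {zero}  p all = z≤n
n≤count {suc k} p all with p zero | all zero
... | true | _ = s≤s (n≤count (p ∘ suc) (all ∘ suc))

n∸1≤count : ∀ {k} (p : Fin k → Bool) {j} → (∀ i → i ≢ j → T (p i)) → k ∸ 1 ≤ count p
n∸1≤count {suc k}       p {zero}  others =
  ≤-trans (n≤count (p ∘ suc) (λ i → others (suc i) (λ ()))) (m≤n+m _ (𝟙 (p zero)))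
n∸1≤count {suc zero}    p {suc ()}
n∸1≤count {suc (suc k)} p {suc j} others with p zero | others zero (λ ())
... | true | _ = s≤s (n∸1≤count (p ∘ suc) (λ i i≢j → others (suc i) (i≢j ∘ suc-injective)))

count-split : ∀ k l (p : Fin (k + l) → Bool) → count p ≡ count (p ∘ (_↑ˡ l)) + count (p ∘ (k ↑ʳ_))
count-split zero    l p = refl
count-split (suc k) l p =
  trans (cong (𝟙 (p zero) +_) (count-split k l (p ∘ suc))) (sym (+-assoc (𝟙 (p zero)) _ _))

-- Double counting the pairs (i , j) with p i and R i j.
count-≤-by-matching : ∀ {k l} (p : Fin k → Bool) (q : Fin l → Bool) (R : Fin k → Fin l → Bool) →
  (∀ i → T (p i) → 1 ≤ count (R i)) →
  (∀ i j → T (p i) → T (R i j) → T (q j)) →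
  (∀ i i′ j → T (p i) → T (p i′) → T (R i j) → T (R i′ j) → i ≡ i′) →
  count p ≤ count q
count-≤-by-matching p q R partnered lands unique = begin
  count p                                  ≡⟨ count≡∑ p ⟩
  ∑ (𝟙 ∘ p)                                ≤⟨ ∑-mono-≤ row ⟩
  ∑ (λ i → count (λ j → p i ∧ R i j))      ≡⟨ ∑-cong (λ i → count≡∑ (λ j → p i ∧ R i j)) ⟩
  ∑ (λ i → ∑ (λ j → 𝟙 (p i ∧ R i j)))      ≡⟨ ∑-swap (λ i j → 𝟙 (p i ∧ R i j)) ⟩
  ∑ (λ j → ∑ (λ i → 𝟙 (p i ∧ R i j)))      ≡⟨ ∑-cong (λ j → count≡∑ (λ i → p i ∧ R i j)) ⟨
  ∑ (λ j → count (λ i → p i ∧ R i j))      ≤⟨ ∑-mono-≤ column ⟩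
  ∑ (𝟙 ∘ q)                                ≡⟨ count≡∑ q ⟨
  count q                                  ∎
  where
  open ≤-Reasoning
  split : ∀ {a b} → T (a ∧ b) → T a × T b
  split = Equivalence.to T-∧

  row : ∀ i → 𝟙 (p i) ≤ count (λ j → p i ∧ R i j)
  row i with p i | partnered i
  ... | true  | has = has tt
  ... | false | _   = z≤n

  column : ∀ j → count (λ i → p i ∧ R i j) ≤ 𝟙 (q j)
  column j with q j in qⱼ
  ... | true  = count≤1 _ (λ i i′ h h′ →
                  unique i i′ j (proj₁ (split h)) (proj₁ (split h′)) (proj₂ (split h)) (proj₂ (split h′)))
  ... | false = ≤-reflexive (count≡0 _ (λ i h →
                  subst T qⱼ (lands i j (proj₁ (split h)) (proj₂ (split h)))))

∣p∣≡count : ∀ {k} (p : Subset k) → ∣ p ∣ ≡ count (lookup p)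
∣p∣≡count []          = refl
∣p∣≡count (true  ∷ p) = cong suc (∣p∣≡count p)
∣p∣≡count (false ∷ p) = ∣p∣≡count p

∈⇒T-lookup : ∀ {k} {p : Subset k} {x} → x ∈ p → T (lookup p x)
∈⇒T-lookup x∈p rewrite []=⇒lookup x∈p = tt

x≢y⇒x∈∁⁅y⁆ : ∀ {k} {x y : Fin k} → x ≢ y → x ∈ ∁ ⁅ y ⁆
x≢y⇒x∈∁⁅y⁆ {y = y} x≢y = x∉p⇒x∈∁p (x≢y ∘ x∈⁅y⁆⇒x≡y y)

x∉∁⁅y⁆⇒x≡y : ∀ {k} {x y : Fin k} → x ∉ ∁ ⁅ y ⁆ → x ≡ y
x∉∁⁅y⁆⇒x≡y {y = y} x∉ = x∈⁅y⁆⇒x≡y y (x∉∁p⇒x∈p x∉)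

∣∁⁅x⁆∣≡n∸1 : ∀ {k} (x : Fin k) → ∣ ∁ ⁅ x ⁆ ∣ ≡ k ∸ 1
∣∁⁅x⁆∣≡n∸1 {k} x = trans (∣∁p∣≡n∸∣p∣ ⁅ x ⁆) (cong (k ∸_) (∣⁅x⁆∣≡1 x))

↑ʳ≢↑ˡ : ∀ {k l} (i : Fin l) (j : Fin k) → k ↑ʳ i ≢ j ↑ˡ l
↑ʳ≢↑ˡ {k} {l} i j eq with trans (sym (splitAt-↑ʳ k l i)) (trans (cong (splitAt k) eq) (splitAt-↑ˡ k j l))
... | ()

avoid-two : ∀ {k} → 3 ≤ k → (a b : Fin k) → ∃[ w ] w ≢ a × w ≢ b
avoid-two (s≤s (s≤s (s≤s _))) a b with 0F ≟ a | 0F ≟ b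
... | no 0≢a | no 0≢b = 0F , 0≢a , 0≢b
... | yes refl | _ with 1F ≟ b
...   | no  1≢b = 1F , (λ ()) , 1≢b
...   | yes refl = 2F , (λ ()) , (λ ())
avoid-two (s≤s (s≤s (s≤s _))) a b | no _ | yes refl with 1F ≟ a
...   | no  1≢a = 1F , 1≢a , (λ ())
...   | yes refl = 2F , (λ ()) , (λ ())

module _ {A : Set} {P : A → Set} {R : A → A → Set} where

  walk-preserves : (S : A → Set) → (∀ {x y} → S x → R x y → S y) → ∀ {x y} → Walk P R x y → S x → S y
  walk-preserves S closed (here _)     Sx = Sx
  walk-preserves S closed (step _ r w) Sx = walk-preserves S closed w (closed Sx r)

  walk-first-step : ∀ {x y} → Walk P R x y → x ≡ y ⊎ ∃[ z ] R x z × P z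
  walk-first-step (here _)                = inj₁ refl
  walk-first-step (step _ r (here Pz))     = inj₂ (_ , r , Pz)
  walk-first-step (step _ r (step Pz _ _)) = inj₂ (_ , r , Pz)

module _ {n m : ℕ} (G : Graph n m) where
  open Graph G

  leaf? : Fin n → Bool
  leaf? v = deg G v ≡ᵇ 1

  incident?-sound : ∀ {v e} → T (incident? G v e) → Incident G v e
  incident?-sound {v} {e} h with v ≟ proj₁ (ends e) | v ≟ proj₂ (ends e)
  ... | yes v≡a | _       = inj₁ v≡a
  ... | no  _   | yes v≡b = inj₂ v≡b

  incident?-complete : ∀ {v e} → Incident G v e → T (incident? G v e)
  incident?-complete {v} {e} v∈e with v ≟ proj₁ (ends e) | v ≟ proj₂ (ends e) | v∈e
  ... | yes _   | _       | _        = tt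
  ... | no  _   | yes _   | _        = tt
  ... | no  v≢a | no  _   | inj₁ v≡a = v≢a v≡a
  ... | no  _   | no  v≢b | inj₂ v≡b = v≢b v≡b

  leaf-incident-unique : ∀ {v e f} → deg G v ≡ 1 → Incident G v e → Incident G v f → e ≡ f
  leaf-incident-unique {v} leaf v∈e v∈f =
    count≡1⇒unique (incident? G v) leaf (incident?-complete v∈e) (incident?-complete v∈f)

  module _ (conn : Connected G) (n≥3 : 3 ≤ n) where

    -- If both ends of e were leaves, {ends of e} would be closed under adjacency, hence
    -- (by connectivity) all of V(G); but n ≥ 3.
    ends-not-both-leaves : ∀ e → deg G (proj₁ (ends e)) ≡ 1 → deg G (proj₂ (ends e)) ≡ 1 → ⊥
    ends-not-both-leaves e leaf₁ leaf₂ with avoid-two n≥3 (proj₁ (ends e)) (proj₂ (ends e))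
    ... | w , w≢a , w≢b =
      [ w≢a , w≢b ] (walk-preserves (λ x → Incident G x e) closed (conn (proj₁ (ends e)) w) (inj₁ refl))
      where
      end-is-leaf : ∀ {x} → Incident G x e → deg G x ≡ 1
      end-is-leaf (inj₁ refl) = leaf₁
      end-is-leaf (inj₂ refl) = leaf₂

      closed : ∀ {x y} → Incident G x e → Adj G x y → Incident G y e
      closed x∈e (f , inj₁ f=xy) with leaf-incident-unique (end-is-leaf x∈e) x∈e (inj₁ (cong proj₁ (sym f=xy)))
      ... | refl = inj₂ (cong proj₂ (sym f=xy))
      closed x∈e (f , inj₂ f=yx) with leaf-incident-unique (end-is-leaf x∈e) x∈e (inj₂ (cong proj₂ (sym f=yx)))
      ... | refl = inj₁ (cong proj₁ (sym f=yx))

    leaves-sharing-edge-equal : ∀ {u v e} → deg G u ≡ 1 → deg G v ≡ 1 → Incident G u e → Incident G v e → u ≡ v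
    leaves-sharing-edge-equal         _      _      (inj₁ u≡a)  (inj₁ v≡a)  = trans u≡a (sym v≡a)
    leaves-sharing-edge-equal         _      _      (inj₂ u≡b)  (inj₂ v≡b)  = trans u≡b (sym v≡b)
    leaves-sharing-edge-equal {e = e} leafᵤ leafᵥ (inj₁ refl) (inj₂ refl) = ⊥-elim (ends-not-both-leaves e leafᵤ leafᵥ)
    leaves-sharing-edge-equal {e = e} leafᵤ leafᵥ (inj₂ refl) (inj₁ refl) = ⊥-elim (ends-not-both-leaves e leafᵥ leafᵤ)

    incident-edge : ∀ v → ∃[ e ] Incident G v e
    incident-edge v with avoid-two n≥3 v v
    ... | w , w≢v , _ with walk-first-step (conn v w)
    ... | inj₁ v≡w                       = ⊥-elim (w≢v (sym v≡w))
    ... | inj₂ (_ , (e , inj₁ e=vy) , _) = e , inj₁ (cong proj₁ (sym e=vy))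
    ... | inj₂ (_ , (e , inj₂ e=yv) , _) = e , inj₂ (cong proj₂ (sym e=yv))

    leafCount≤n∸1 : Fin m → leafCount G ≤ n ∸ 1
    leafCount≤n∸1 e with deg G (proj₁ (ends e)) ≟ℕ 1
    ... | yes leaf₁  = count≤n∸1 leaf? {proj₂ (ends e)} (ends-not-both-leaves e leaf₁ ∘ ≡ᵇ⇒≡ _ _)
    ... | no  ¬leaf₁ = count≤n∸1 leaf? {proj₁ (ends e)} (¬leaf₁ ∘ ≡ᵇ⇒≡ _ _)

module _ {n m : ℕ} (G : Graph n m) where
  open Graph G

  vertex-neighbour : ∀ {v y} → MAdj G (v ↑ˡ m) y → ∃[ f ] y ≡ n ↑ʳ f × Incident G v f
  vertex-neighbour {v} {y} adj with splitAt n y in y≡f | subst (λ s → MAdj⊎ G s (splitAt n y)) (splitAt-↑ˡ n v m) adj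
  ... | inj₂ f | v∈f = f , sym (splitAt⁻¹-↑ʳ y≡f) , v∈f

  MAdj-join : ∀ x t → MAdj⊎ G (splitAt n x) t → MAdj G x (join n m t)
  MAdj-join x t = subst (MAdj⊎ G (splitAt n x)) (sym (splitAt-join n m t))

  leaf-edge∈ : ∀ {D v e} → TotalDominating G D → deg G v ≡ 1 → Incident G v e → n ↑ʳ e ∈ D
  leaf-edge∈ {v = v} td leaf v∈e with td (v ↑ˡ m)
  ... | y , y∈D , adj with vertex-neighbour adj
  ... | f , refl , v∈f with leaf-incident-unique G leaf v∈e v∈f
  ... | refl = y∈D

  leaf∉⇒complement≡⁅leaf⁆ : ∀ {D v} → IsTOCDS G D → deg G v ≡ 1 → v ↑ˡ m ∉ D → ∀ x → x ∉ D → x ≡ v ↑ˡ m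
  leaf∉⇒complement≡⁅leaf⁆ {v = v} (td , oc) leaf v∉D x x∉D with walk-first-step (oc (v ↑ˡ m) x v∉D x∉D)
  ... | inj₁ v≡x = sym v≡x
  ... | inj₂ (y , adj , y∉D) with vertex-neighbour adj
  ... | f , refl , v∈f = ⊥-elim (y∉D (leaf-edge∈ td leaf v∈f))

  module _ (conn : Connected G) (n≥3 : 3 ≤ n) {D : Subset (n + m)} (tocds : IsTOCDS G D) where

    leafCount≤edges∈ : leafCount G ≤ count (λ e → lookup D (n ↑ʳ e))
    leafCount≤edges∈ = count-≤-by-matching (leaf? G) _ (incident? G)
      (λ v leaf → ≤-reflexive (sym (≡ᵇ⇒≡ _ _ leaf)))
      (λ v e leaf v∈e → ∈⇒T-lookup (leaf-edge∈ (proj₁ tocds) (≡ᵇ⇒≡ _ _ leaf) (incident?-sound G {v} v∈e)))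
      (λ u v e leafᵤ leafᵥ u∈e v∈e → leaves-sharing-edge-equal G conn n≥3
        (≡ᵇ⇒≡ _ _ leafᵤ) (≡ᵇ⇒≡ _ _ leafᵥ) (incident?-sound G {u} u∈e) (incident?-sound G {v} v∈e))

    leafCount≤vertices∈ : leafCount G ≤ count (λ v → lookup D (v ↑ˡ m))
    leafCount≤vertices∈ with any? (λ v → T? (leaf? G v) ×-dec ¬? (v ↑ˡ m ∈? D))
    ... | no ¬∃ = count-mono (leaf? G) _ λ v leaf →
      ∈⇒T-lookup (decidable-stable (v ↑ˡ m ∈? D) (λ v∉D → ¬∃ (v , leaf , v∉D)))
    ... | yes (v₀ , leaf , v₀∉D) =
      ≤-trans (leafCount≤n∸1 G conn n≥3 (proj₁ (incident-edge G conn n≥3 v₀))) (n∸1≤count _ others∈)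
      where
      others∈ : ∀ v → v ≢ v₀ → T (lookup D (v ↑ˡ m))
      others∈ v v≢v₀ = ∈⇒T-lookup (decidable-stable (v ↑ˡ m ∈? D) λ v∉D →
        v≢v₀ (↑ˡ-injective m v v₀ (leaf∉⇒complement≡⁅leaf⁆ tocds (≡ᵇ⇒≡ _ _ leaf) v₀∉D _ v∉D)))

    twice-leafCount≤ : 2 * leafCount G ≤ ∣ D ∣
    twice-leafCount≤ = begin
      2 * leafCount G
        ≡⟨ cong (leafCount G +_) (+-identityʳ (leafCount G)) ⟩
      leafCount G + leafCount G
        ≤⟨ +-mono-≤ leafCount≤vertices∈ leafCount≤edges∈ ⟩
      count (λ v → lookup D (v ↑ˡ m)) + count (λ e → lookup D (n ↑ʳ e))
        ≡⟨ count-split n m (lookup D) ⟨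
      count (lookup D)
        ≡⟨ ∣p∣≡count D ⟨
      ∣ D ∣ ∎
      where open ≤-Reasoning

  ∁⁅vertex⁆-isTOCDS : Connected G → 3 ≤ n → ∀ w → IsTOCDS G (∁ ⁅ w ↑ˡ m ⁆)
  ∁⁅vertex⁆-isTOCDS conn n≥3 w = dominating , connected
    where
    vertex∈ : ∀ {v} → v ≢ w → v ↑ˡ m ∈ ∁ ⁅ w ↑ˡ m ⁆
    vertex∈ {v} v≢w = x≢y⇒x∈∁⁅y⁆ (v≢w ∘ ↑ˡ-injective m v w)

    neighbour∈ : ∀ s → ∃[ t ] join n m t ∈ ∁ ⁅ w ↑ˡ m ⁆ × MAdj⊎ G s t
    neighbour∈ (inj₁ v) with incident-edge G conn n≥3 v
    ... | e , v∈e = inj₂ e , x≢y⇒x∈∁⁅y⁆ (↑ʳ≢↑ˡ e w) , v∈e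
    neighbour∈ (inj₂ e) with proj₁ (ends e) ≟ w
    ... | no  a≢w = inj₁ (proj₁ (ends e)) , vertex∈ a≢w , inj₁ refl
    ... | yes a≡w = inj₁ (proj₂ (ends e)) , vertex∈ (λ b≡w → <⇒≢ (ordered e) (trans a≡w (sym b≡w))) , inj₂ refl

    dominating : TotalDominating G (∁ ⁅ w ↑ˡ m ⁆)
    dominating x with neighbour∈ (splitAt n x)
    ... | t , t∈ , adj = join n m t , t∈ , MAdj-join x t adj

    connected : OuterConnected G (∁ ⁅ w ↑ˡ m ⁆)
    connected x y x∉ y∉ = subst (Walk (_∉ ∁ ⁅ w ↑ˡ m ⁆) (MAdj G) x)
      (trans (x∉∁⁅y⁆⇒x≡y x∉) (sym (x∉∁⁅y⁆⇒x≡y y∉))) (here x∉)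

theorem2p2 : ∀ (n m : ℕ) (G : Graph n m) → 3 ≤ n → Connected G →
    ((D : Subset (n + m)) → IsTOCDS G D → 2 * leafCount G ≤ ∣ D ∣)
    × (∃[ D ] (IsTOCDS G D × ∣ D ∣ ≤ n + m ∸ 1))
theorem2p2 n m G n≥3 conn =
  (λ D tocds → twice-leafCount≤ G conn n≥3 tocds) ,
  (∁ ⁅ w ↑ˡ m ⁆ , ∁⁅vertex⁆-isTOCDS G conn n≥3 w , ≤-reflexive (∣∁⁅x⁆∣≡n∸1 (w ↑ˡ m)))
  where
  w : Fin n
  w = fromℕ< n≥3
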